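{- Let $q$ be a prime power, let $0\le l\le r$ be integers, and let $\mathcal{M}$ be a $q^r$-divisible multiset of points in $\mathrm{PG}(v-1,q)$ of cardinality $n=q^l\cdot[r+1-l]_q$, where $[m]_q=(q^m-1)/(q-1)$. Then there exists an $(r+1-l)$-dimensional subspace $K$ such that $\mathcal{M}=q^l\cdot\chi_K$.
   Context: $\mathrm{PG}(v-1,q)$ is the projective geometry of $\mathbb{F}_q^v$; points are $1$-dimensional subspaces, hyperplanes are $(v-1)$-dimensional subspaces. A multiset of points $\mathcal{M}$ assigns to each point $P$ a multiplicity $\mathcal{M}(P)\in\{0,1,2,\dots\}$; for a subspace $K$, $\mathcal{M}(K)=\sum_{P\le K}\mathcal{M}(P)$ and $\#\mathcal{M}=\mathcal{M}(\mathbb{F}_q^v)$. $\mathcal{M}$ is $\Delta$-divisible if $\mathcal{M}(H)\equiv\#\mathcal{M}\pmod{\Delta}$ for every hyperplane $H$. For a subspace $K$, $\chi_K$ is the multiset with $\chi_K(P)=1$ if $P\le K$ and $0$ otherwise; scalar multiples are taken pointwise. -}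

module Defs where

open import Level using (0ℓ)
open import Data.Nat as ℕ using (ℕ; zero; suc; _^_)
open import Data.Nat.Primality using (Prime)
open import Data.Integer as ℤ using (ℤ; +_)
open import Data.Integer.Divisibility using () renaming (_∣_ to _∣ℤ_)
open import Data.Fin using (Fin)
open import Data.Vec using (Vec; []; _∷_; replicate; zipWith)
open import Data.List using (List; []; _∷_; map; concatMap; allFin)
open import Data.Nat.ListAction using (sum)
open import Data.List.Relation.Unary.Any using (Any; any?)
open import Data.Product using (Σ; ∃; _×_; _,_; proj₁)
open import Data.Sum using (_⊎_)
open import Data.Empty using (⊥)
open import Relation.Nullary using (¬_; Dec; yes; no)
open import Relation.Nullary.Decidable using (_⊎-dec_; _×-dec_)
open import Relation.Binary.PropositionalEquality using (_≡_; _≢_)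
open import Function.Bundles using (_↔_; Inverse)
open import Algebra.Structures using (IsCommutativeRing)

IsPrimePower : ℕ → Set
IsPrimePower q = Σ ℕ λ p → Σ ℕ λ k → Prime p × (1 ℕ.≤ k) × (q ≡ p ^ k)

record FiniteField (q : ℕ) : Set₁ where
  field
    Carrier : Set
    _+_ _*_ : Carrier → Carrier → Carrier
    -_ : Carrier → Carrier
    0# 1# : Carrier
    isCommutativeRing : IsCommutativeRing _≡_ _+_ _*_ -_ 0# 1#
    0≢1 : 0# ≢ 1#
    inverse : ∀ x → x ≢ 0# → ∃ λ y → x * y ≡ 1#
    _≟_ : (x y : Carrier) → Dec (x ≡ y)
    enumeration : Fin q ↔ Carrier

-- [m]_q = (q^m - 1)/(q - 1) = 1 + q + ... + q^(m-1)  (exact for q ≥ 2)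
gaussNum : ℕ → ℕ → ℕ
gaussNum q zero = 0
gaussNum q (suc m) = 1 ℕ.+ q ℕ.* gaussNum q m

_≡_[mod_] : ℕ → ℕ → ℕ → Set
a ≡ b [mod Δ ] = (+ Δ) ∣ℤ ((+ a) ℤ.- (+ b))

module Geometry {q : ℕ} (F : FiniteField q) where
  open FiniteField F

  V : ℕ → Set
  V v = Vec Carrier v

  elems : List Carrier
  elems = map (Inverse.to enumeration) (allFin q)

  allVecs : (v : ℕ) → List (V v)
  allVecs zero = [] ∷ []
  allVecs (suc v) = concatMap (λ x → map (x ∷_) (allVecs v)) elems

  zeroV : ∀ {v} → V v
  zeroV = replicate _ 0#

  _+V_ : ∀ {v} → V v → V v → V v
  _+V_ = zipWith _+_

  _·V_ : ∀ {v} → Carrier → V v → V v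
  c ·V x = Data.Vec.map (c *_) x

  linComb : ∀ {v k} → V k → Vec (V v) k → V v
  linComb [] [] = zeroV
  linComb (c ∷ cs) (b ∷ bs) = (c ·V b) +V linComb cs bs

  LinIndep : ∀ {v k} → Vec (V v) k → Set
  LinIndep {v} {k} B = (c : V k) → linComb c B ≡ zeroV → c ≡ zeroV

  InSpan : ∀ {v k} → Vec (V v) k → V v → Set
  InSpan {v} {k} B x = Any (λ c → linComb c B ≡ x) (allVecs k)

  _≟V_ : ∀ {v} → (x y : V v) → Dec (x ≡ y)
  x ≟V y = Data.Vec.Properties.≡-dec _≟_ x y
    where import Data.Vec.Properties

  inSpan? : ∀ {v k} (B : Vec (V v) k) (x : V v) → Dec (InSpan B x)
  inSpan? {v} {k} B x = any? (λ c → linComb c B ≟V x) (allVecs k)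

  Normalized : ∀ {v} → V v → Set
  Normalized [] = ⊥
  Normalized (x ∷ xs) = (x ≡ 1#) ⊎ ((x ≡ 0#) × Normalized xs)

  normalized? : ∀ {v} (x : V v) → Dec (Normalized x)
  normalized? [] = no (λ ())
  normalized? (x ∷ xs) = (x ≟ 1#) ⊎-dec ((x ≟ 0#) ×-dec normalized? xs)

  -- points of PG(v-1,q) = 1-dim subspaces, represented by normalized vectors
  Point : ℕ → Set
  Point v = Σ (V v) Normalized

  Multiset : ℕ → Set
  Multiset v = Point v → ℕ

  mult : ∀ {v} → Multiset v → V v → ℕ
  mult M x with normalized? x
  ... | yes p = M (x , p)
  ... | no _ = 0

  χ : ∀ {v k} → Vec (V v) k → V v → ℕ
  χ B x with inSpan? B x
  ... | yes _ = 1
  ... | no _ = 0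

  card : ∀ {v} → Multiset v → ℕ
  card {v} M = sum (map (mult M) (allVecs v))

  massOf : ∀ {v k} → Multiset v → Vec (V v) k → ℕ
  massOf {v} M B = sum (map (λ x → mult M x ℕ.* χ B x) (allVecs v))

  -- Δ-divisible: M(H) ≡ #M (mod Δ) for every hyperplane H
  -- (a hyperplane is the span of k linearly independent vectors, 1 + k = v)
  Divisible : ∀ {v} → ℕ → Multiset v → Set
  Divisible {v} Δ M = (k : ℕ) → suc k ≡ v → (B : Vec (V v) k) → LinIndep B →
    massOf M B ≡ card M [mod Δ ]

-- For a nonzero functional a, the mass of M off the hyperplane ker a is a multiple of q^r by
-- divisibility, and #M = q^l [r+1-l] gives q·q^r + #M = q·#M + q^l, whence #M < 2q^r: so that
-- mass is 0 or q^r. Let K be the common kernel of the functionals of the first kind; it contains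
-- the support of M. For a point x of K every functional not vanishing at x has off-mass q^r, and
-- double counting the pairs (a, y) with a(x) ≠ 0 ≠ a(y), weighted by M(y), yields
-- q·q^r + #M = q·#M + M(x), so M(x) = q^l. Then #M = q^l · #points(K) forces K to have [r+1-l]
-- points, i.e. dimension r+1-l.
module Submission where

open import Defs
open import Level using (Level; 0ℓ)
open import Data.Nat as ℕ using (ℕ; zero; suc; _+_; _*_; _∸_; _^_; _≤_; _<_; z≤n; s≤s)
import Data.Nat.Properties as ℕ
open import Data.Nat.Divisibility using (_∣_; divides)
open import Data.Nat.Tactic.RingSolver using (solve-∀)
import Data.Integer as ℤ
import Data.Integer.Properties as ℤ
open import Data.Integer.Divisibility using () renaming (_∣_ to _∣ℤ_)
open import Data.Fin as Fin using (Fin)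
import Data.Fin.Properties as Fin
open import Data.List as List using (List; []; _∷_; _++_; map; concatMap; allFin; length)
import Data.List.Properties as List
open import Data.Nat.ListAction using (sum)
open import Data.List.Relation.Unary.Any as Any using (here; there)
open import Data.List.Relation.Unary.All as All using (all?)
open import Data.List.Membership.Propositional using (_∈_; lose)
open import Data.Vec as Vec using (Vec; []; _∷_)
import Data.Vec.Properties as Vec
open import Data.Product using (Σ; ∃; _×_; _,_; proj₁)
open import Data.Sum using (_⊎_; inj₁; inj₂)
open import Data.Empty using (⊥-elim)
open import Function using (_∘_; id)
open import Function.Bundles using (Inverse)
open import Relation.Nullary using (¬_; Dec; yes; no; ¬?)
open import Relation.Nullary.Decidable using (_×-dec_; _→-dec_; map′)
open import Relation.Binary using (tri<; tri≈; tri>)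
open import Relation.Binary.PropositionalEquality
open import Axiom.UniquenessOfIdentityProofs using (module Decidable⇒UIP)
open import Algebra.Structures using (IsCommutativeRing)
open import Algebra.Bundles using (CommutativeRing)

private
  variable
    a b : Level
    A : Set a
    B : Set b

𝟙 : Dec A → ℕ
𝟙 (yes _) = 1
𝟙 (no _)  = 0

𝟙-cong : (A → B) → (B → A) → (x : Dec A) (y : Dec B) → 𝟙 x ≡ 𝟙 y
𝟙-cong f g (yes p) (yes q) = refl
𝟙-cong f g (yes p) (no ¬q) = ⊥-elim (¬q (f p))
𝟙-cong f g (no ¬p) (yes q) = ⊥-elim (¬p (g q))
𝟙-cong f g (no ¬p) (no ¬q) = refl

𝟙-yes : A → (x : Dec A) → 𝟙 x ≡ 1
𝟙-yes p (yes _) = refl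
𝟙-yes p (no ¬p) = ⊥-elim (¬p p)

𝟙-no : ¬ A → (x : Dec A) → 𝟙 x ≡ 0
𝟙-no ¬p (yes p) = ⊥-elim (¬p p)
𝟙-no ¬p (no _)  = refl

𝟙≢0⇒ : (x : Dec A) → 𝟙 x ≢ 0 → A
𝟙≢0⇒ (yes p) _ = p
𝟙≢0⇒ (no _) ne = ⊥-elim (ne refl)

𝟙≤1 : (x : Dec A) → 𝟙 x ≤ 1
𝟙≤1 (yes _) = s≤s z≤n
𝟙≤1 (no _)  = z≤n

𝟙-× : (x : Dec A) (y : Dec B) → 𝟙 x * 𝟙 y ≡ 𝟙 (x ×-dec y)
𝟙-× (yes _) (yes _) = refl
𝟙-× (yes _) (no _)  = refl
𝟙-× (no _)  _       = refl

𝟙-idem : (x : Dec A) → 𝟙 x * 𝟙 x ≡ 𝟙 x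
𝟙-idem (yes _) = refl
𝟙-idem (no _)  = refl

𝟙+𝟙¬ : (x : Dec A) → 𝟙 x + 𝟙 (¬? x) ≡ 1
𝟙+𝟙¬ (yes _) = refl
𝟙+𝟙¬ (no _)  = refl

*𝟙+*𝟙¬ : ∀ n (x : Dec A) → n * 𝟙 x + n * 𝟙 (¬? x) ≡ n
*𝟙+*𝟙¬ n x = trans (sym (ℕ.*-distribˡ-+ n _ _)) (trans (cong (n *_) (𝟙+𝟙¬ x)) (ℕ.*-identityʳ n))

∑ : List A → (A → ℕ) → ℕ
∑ xs f = sum (map f xs)

-- The body of ∑[ x ∈ xs ] extends over _+_ and _*_, so a sum used as an operand needs parentheses.
infix 5 ∑
syntax ∑ xs (λ x → e) = ∑[ x ∈ xs ] e

∑-cong : (xs : List A) {f g : A → ℕ} → (∀ x → f x ≡ g x) → ∑ xs f ≡ ∑ xs g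
∑-cong []       eq = refl
∑-cong (x ∷ xs) eq = cong₂ _+_ (eq x) (∑-cong xs eq)

∑-+ : (xs : List A) (f g : A → ℕ) → ∑[ x ∈ xs ] (f x + g x) ≡ ∑ xs f + ∑ xs g
∑-+ []       f g = refl
∑-+ (x ∷ xs) f g = trans (cong (f x + g x +_) (∑-+ xs f g)) (exchange (f x) (g x) _ _)
  where
  exchange : ∀ m n o p → (m + n) + (o + p) ≡ (m + o) + (n + p)
  exchange = solve-∀

∑-*ˡ : (xs : List A) (k : ℕ) (f : A → ℕ) → ∑[ x ∈ xs ] (k * f x) ≡ k * ∑ xs f
∑-*ˡ []       k f = sym (ℕ.*-zeroʳ k)
∑-*ˡ (x ∷ xs) k f = trans (cong (k * f x +_) (∑-*ˡ xs k f)) (sym (ℕ.*-distribˡ-+ k (f x) _))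

∑-*ʳ : (xs : List A) (k : ℕ) (f : A → ℕ) → ∑[ x ∈ xs ] (f x * k) ≡ ∑ xs f * k
∑-*ʳ xs k f = trans (∑-cong xs (λ x → ℕ.*-comm (f x) k)) (trans (∑-*ˡ xs k f) (ℕ.*-comm k _))

∑-const : (xs : List A) (k : ℕ) → ∑[ _ ∈ xs ] k ≡ length xs * k
∑-const []       k = refl
∑-const (x ∷ xs) k = cong (k +_) (∑-const xs k)

∑-++ : (xs ys : List A) (f : A → ℕ) → ∑ (xs ++ ys) f ≡ ∑ xs f + ∑ ys f
∑-++ []       ys f = refl
∑-++ (x ∷ xs) ys f = trans (cong (f x +_) (∑-++ xs ys f)) (sym (ℕ.+-assoc (f x) _ _))

≤∑ : (xs : List A) (f : A → ℕ) {x : A} → x ∈ xs → f x ≤ ∑ xs f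
≤∑ (y ∷ xs) f (here refl) = ℕ.m≤m+n (f y) _
≤∑ (y ∷ xs) f (there x∈)  = ℕ.≤-trans (≤∑ xs f x∈) (ℕ.m≤n+m _ (f y))

∑≡0⇒ : (xs : List A) (f : A → ℕ) {x : A} → x ∈ xs → ∑ xs f ≡ 0 → f x ≡ 0
∑≡0⇒ xs f x∈ eq = ℕ.n≤0⇒n≡0 (subst (f _ ≤_) eq (≤∑ xs f x∈))

∑≢0⇒ : (xs : List A) (f : A → ℕ) → ∑ xs f ≢ 0 → ∃ λ x → x ∈ xs × f x ≢ 0
∑≢0⇒ []       f ne = ⊥-elim (ne refl)
∑≢0⇒ (x ∷ xs) f ne with f x ℕ.≟ 0
... | no fx≢0 = x , here refl , fx≢0
... | yes fx≡0 with ∑≢0⇒ xs f (λ e → ne (cong₂ _+_ fx≡0 e))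
...   | y , y∈ , fy≢0 = y , there y∈ , fy≢0

∑-mono-≤ : (xs : List A) {f g : A → ℕ} → (∀ x → f x ≤ g x) → ∑ xs f ≤ ∑ xs g
∑-mono-≤ []       le = z≤n
∑-mono-≤ (x ∷ xs) le = ℕ.+-mono-≤ (le x) (∑-mono-≤ xs le)

∑-comm : (xs : List A) (ys : List B) (f : A → B → ℕ) →
  ∑[ x ∈ xs ] ∑[ y ∈ ys ] f x y ≡ ∑[ y ∈ ys ] ∑[ x ∈ xs ] f x y
∑-comm []       ys f = sym (trans (∑-const ys 0) (ℕ.*-zeroʳ (length ys)))
∑-comm (x ∷ xs) ys f = trans (cong (∑ ys (f x) +_) (∑-comm xs ys f))
  (sym (∑-+ ys (f x) (λ y → ∑[ x′ ∈ xs ] f x′ y)))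

∑-map : (xs : List A) (g : A → B) (f : B → ℕ) → ∑ (map g xs) f ≡ ∑[ x ∈ xs ] f (g x)
∑-map []       g f = refl
∑-map (x ∷ xs) g f = cong (f (g x) +_) (∑-map xs g f)

∑-concatMap : (xs : List A) (g : A → List B) (f : B → ℕ) →
  ∑ (concatMap g xs) f ≡ ∑[ x ∈ xs ] ∑ (g x) f
∑-concatMap []       g f = refl
∑-concatMap (x ∷ xs) g f =
  trans (∑-++ (g x) (concatMap g xs) f) (cong (∑ (g x) f +_) (∑-concatMap xs g f))

∑-allFin-δ : (n : ℕ) (j : Fin n) → ∑[ i ∈ allFin n ] 𝟙 (i Fin.≟ j) ≡ 1
∑-allFin-δ (suc n) j = begin
  ∑[ i ∈ allFin (suc n) ] 𝟙 (i Fin.≟ j)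
    ≡⟨ cong (λ is → 𝟙 (Fin.zero Fin.≟ j) + ∑ is (λ i → 𝟙 (i Fin.≟ j))) (List.map-tabulate id Fin.suc) ⟨
  𝟙 (Fin.zero Fin.≟ j) + ∑ (map Fin.suc (allFin n)) (λ i → 𝟙 (i Fin.≟ j))
    ≡⟨ cong (𝟙 (Fin.zero Fin.≟ j) +_) (∑-map (allFin n) Fin.suc _) ⟩
  𝟙 (Fin.zero Fin.≟ j) + (∑[ i ∈ allFin n ] 𝟙 (Fin.suc i Fin.≟ j))
    ≡⟨ step j ⟩
  1 ∎
  where
  open ≡-Reasoning
  step : (j : Fin (suc n)) → 𝟙 (Fin.zero Fin.≟ j) + (∑[ i ∈ allFin n ] 𝟙 (Fin.suc i Fin.≟ j)) ≡ 1
  step Fin.zero    = cong suc (trans (∑-cong (allFin n) (λ i → 𝟙-no (λ ()) (Fin.suc i Fin.≟ Fin.zero)))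
                                     (trans (∑-const (allFin n) 0) (ℕ.*-zeroʳ (length (allFin n)))))
  step (Fin.suc j) = trans (∑-cong (allFin n) (λ i → 𝟙-cong Fin.suc-injective (cong Fin.suc)
                                                     (Fin.suc i Fin.≟ Fin.suc j) (i Fin.≟ j)))
                           (∑-allFin-δ n j)

^-injectiveʳ : ∀ m → 1 < m → ∀ {i j} → m ^ i ≡ m ^ j → i ≡ j
^-injectiveʳ m 1<m {i} {j} eq with ℕ.<-cmp i j
... | tri< i<j _ _ = ⊥-elim (ℕ.<-irrefl eq (ℕ.^-monoʳ-< m 1<m i<j))
... | tri≈ _ i≡j _ = i≡j
... | tri> _ _ j<i = ⊥-elim (ℕ.<-irrefl (sym eq) (ℕ.^-monoʳ-< m 1<m j<i))

m∣n∧0<n<2m⇒n≡m : ∀ {m n} → 0 < n → n < 2 * m → m ∣ n → n ≡ m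
m∣n∧0<n<2m⇒n≡m     0<n n<2m (divides zero          refl) = ⊥-elim (ℕ.<-irrefl refl 0<n)
m∣n∧0<n<2m⇒n≡m     0<n n<2m (divides (suc zero)    refl) = ℕ.+-identityʳ _
m∣n∧0<n<2m⇒n≡m {m} 0<n n<2m (divides (suc (suc k)) refl) =
  ⊥-elim (ℕ.<-irrefl refl (ℕ.<-≤-trans n<2m (ℕ.≤-trans (ℕ.m≤m+n (2 * m) (k * m)) (ℕ.≤-reflexive (expand k m)))))
  where
  expand : ∀ k m → 2 * m + k * m ≡ (2 + k) * m
  expand = solve-∀

m+n≡o∧d∣m-o⇒d∣n : ∀ {d m n o} → m + n ≡ o → (ℤ.+ d) ∣ℤ ((ℤ.+ m) ℤ.- (ℤ.+ o)) → d ∣ n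
m+n≡o∧d∣m-o⇒d∣n {d} {m} {n} {o} refl = subst (d ∣_) (begin
  ℤ.∣ (ℤ.+ m) ℤ.- (ℤ.+ (m + n)) ∣ ≡⟨ cong ℤ.∣_∣ (ℤ.[+m]-[+n]≡m⊖n m (m + n)) ⟩
  ℤ.∣ m ℤ.⊖ (m + n) ∣           ≡⟨ ℤ.∣m⊖n∣≡∣n⊖m∣ m (m + n) ⟩
  ℤ.∣ (m + n) ℤ.⊖ m ∣           ≡⟨ cong ℤ.∣_∣ (ℤ.⊖-≥ (ℕ.m≤m+n m n)) ⟩
  m + n ∸ m                     ≡⟨ ℕ.m+n∸m≡n m n ⟩
  n                             ∎)
  where open ≡-Reasoning

gaussNum[1+m]≡q^m+gaussNum[m] : ∀ q m → gaussNum q (suc m) ≡ q ^ m + gaussNum q m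
gaussNum[1+m]≡q^m+gaussNum[m] q zero    = cong suc (ℕ.*-zeroʳ q)
gaussNum[1+m]≡q^m+gaussNum[m] q (suc m) =
  trans (cong (λ G → 1 + q * G) (gaussNum[1+m]≡q^m+gaussNum[m] q m)) (expand q (q ^ m) (gaussNum q m))
  where
  expand : ∀ q Q G → 1 + q * (Q + G) ≡ q * Q + (1 + q * G)
  expand = solve-∀

q*q^r+N≡q*N+q^l : ∀ q {l r} → l ≤ r →
  let N = q ^ l * gaussNum q (suc r ∸ l) in q * q ^ r + N ≡ q * N + q ^ l
q*q^r+N≡q*N+q^l q {l} {r} l≤r = begin
  q * q ^ r + q ^ l * G      ≡⟨ cong (λ e → q ^ e + q ^ l * G) (ℕ.m+[n∸m]≡n (ℕ.m≤n⇒m≤1+n l≤r)) ⟨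
  q ^ (l + d) + q ^ l * G    ≡⟨ cong (_+ q ^ l * G) (ℕ.^-distribˡ-+-* q l d) ⟩
  q ^ l * q ^ d + q ^ l * G  ≡⟨ ℕ.*-distribˡ-+ (q ^ l) (q ^ d) G ⟨
  q ^ l * (q ^ d + G)        ≡⟨ cong (q ^ l *_) (gaussNum[1+m]≡q^m+gaussNum[m] q d) ⟨
  q ^ l * (1 + q * G)        ≡⟨ expand q (q ^ l) G ⟩
  q * (q ^ l * G) + q ^ l    ∎
  where
  open ≡-Reasoning
  d G : ℕ
  d = suc r ∸ l
  G = gaussNum q d
  expand : ∀ q Q G → Q * (1 + q * G) ≡ q * (Q * G) + Q
  expand = solve-∀

q*m+n≡q*n+e⇒n<2m : ∀ {q m n e} → 2 ≤ q → 0 < e → q * m + n ≡ q * n + e → n < 2 * m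
q*m+n≡q*n+e⇒n<2m {q} {m} {n} {e} (s≤s (s≤s {n = s} z≤n)) 0<e eq with ℕ.<-≤-connex n (2 * m)
... | inj₁ n<2m = n<2m
... | inj₂ 2m≤n = ⊥-elim (ℕ.<-irrefl refl (begin-strict
  q * m + n          ≡⟨ expand s m n ⟩
  2 * m + s * m + n  ≤⟨ ℕ.+-monoˡ-≤ n (ℕ.+-mono-≤ 2m≤n (ℕ.*-monoʳ-≤ s m≤n)) ⟩
  n + s * n + n      ≡⟨ regroup s n ⟨
  q * n              <⟨ ℕ.m<m+n (q * n) 0<e ⟩
  q * n + e          ≡⟨ eq ⟨
  q * m + n          ∎))
  where
  open ℕ.≤-Reasoning
  m≤n : m ≤ n
  m≤n = ℕ.≤-trans (ℕ.m≤m+n m (m + 0)) 2m≤n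
  expand : ∀ s m n → (2 + s) * m + n ≡ 2 * m + s * m + n
  expand = solve-∀
  regroup : ∀ s n → (2 + s) * n ≡ n + s * n + n
  regroup = solve-∀

module _ {q : ℕ} (F : FiniteField q) where

  open FiniteField F renaming (_+_ to infixl 6 _⊕_; _*_ to infixl 7 _⊗_; _≟_ to infix 4 _≟_)
  open IsCommutativeRing isCommutativeRing
    using (+-assoc; +-comm; +-identityˡ; +-identityʳ; -‿inverseˡ; -‿inverseʳ;
           *-assoc; *-comm; *-identityˡ; *-identityʳ; distribˡ; distribʳ; zeroˡ; zeroʳ)
  open Geometry F

  ring : CommutativeRing 0ℓ 0ℓ
  ring = record { isCommutativeRing = isCommutativeRing }

  open import Algebra.Properties.CommutativeSemigroup (CommutativeRing.+-commutativeSemigroup ring)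
    using (interchange)
  open import Algebra.Properties.CommutativeSemigroup (CommutativeRing.*-commutativeSemigroup ring)
    using () renaming (x∙yz≈y∙xz to x⊗yz≡y⊗xz)
  open import Algebra.Properties.Group (CommutativeRing.+-group ring)
    using () renaming (identityˡ-unique to ⊕-identityˡ-unique; ⁻¹-involutive to -‿involutive)
  open import Algebra.Properties.Ring (CommutativeRing.ring ring) using (-‿distribˡ-*)

  infixl 6 _⊞_
  infixr 7 _⊡_
  infix  8 _·_

  _⊞_ : ∀ {v} → V v → V v → V v
  _⊞_ = _+V_

  _⊡_ : ∀ {v} → Carrier → V v → V v
  _⊡_ = _·V_

  -V_ : ∀ {v} → V v → V v
  -V x = (- 1#) ⊡ x

  _·_ : ∀ {v} → V v → V v → Carrier
  []       · []       = 0#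
  (a ∷ as) · (x ∷ xs) = a ⊗ x ⊕ as · xs

  ⊞-comm : ∀ {v} (x y : V v) → x ⊞ y ≡ y ⊞ x
  ⊞-comm []       []       = refl
  ⊞-comm (x ∷ xs) (y ∷ ys) = cong₂ _∷_ (+-comm x y) (⊞-comm xs ys)

  ⊞-assoc : ∀ {v} (x y z : V v) → (x ⊞ y) ⊞ z ≡ x ⊞ (y ⊞ z)
  ⊞-assoc []       []       []       = refl
  ⊞-assoc (x ∷ xs) (y ∷ ys) (z ∷ zs) = cong₂ _∷_ (+-assoc x y z) (⊞-assoc xs ys zs)

  ⊞-identityˡ : ∀ {v} (x : V v) → zeroV ⊞ x ≡ x
  ⊞-identityˡ []       = refl
  ⊞-identityˡ (x ∷ xs) = cong₂ _∷_ (+-identityˡ x) (⊞-identityˡ xs)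

  ⊞-identityʳ : ∀ {v} (x : V v) → x ⊞ zeroV ≡ x
  ⊞-identityʳ x = trans (⊞-comm x zeroV) (⊞-identityˡ x)

  ⊡-distribˡ-⊞ : ∀ {v} c (x y : V v) → c ⊡ (x ⊞ y) ≡ c ⊡ x ⊞ c ⊡ y
  ⊡-distribˡ-⊞ c []       []       = refl
  ⊡-distribˡ-⊞ c (x ∷ xs) (y ∷ ys) = cong₂ _∷_ (distribˡ c x y) (⊡-distribˡ-⊞ c xs ys)

  ⊡-distribʳ-⊕ : ∀ {v} c d (x : V v) → (c ⊕ d) ⊡ x ≡ c ⊡ x ⊞ d ⊡ x
  ⊡-distribʳ-⊕ c d []       = refl
  ⊡-distribʳ-⊕ c d (x ∷ xs) = cong₂ _∷_ (distribʳ x c d) (⊡-distribʳ-⊕ c d xs)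

  ⊡-assoc : ∀ {v} c d (x : V v) → (c ⊗ d) ⊡ x ≡ c ⊡ d ⊡ x
  ⊡-assoc c d []       = refl
  ⊡-assoc c d (x ∷ xs) = cong₂ _∷_ (*-assoc c d x) (⊡-assoc c d xs)

  ⊡-identityˡ : ∀ {v} (x : V v) → 1# ⊡ x ≡ x
  ⊡-identityˡ []       = refl
  ⊡-identityˡ (x ∷ xs) = cong₂ _∷_ (*-identityˡ x) (⊡-identityˡ xs)

  ⊡-zeroˡ : ∀ {v} (x : V v) → 0# ⊡ x ≡ zeroV
  ⊡-zeroˡ []       = refl
  ⊡-zeroˡ (x ∷ xs) = cong₂ _∷_ (zeroˡ x) (⊡-zeroˡ xs)

  ⊡-zeroʳ : ∀ {v} c → c ⊡ zeroV {v} ≡ zeroV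
  ⊡-zeroʳ {zero}  c = refl
  ⊡-zeroʳ {suc v} c = cong₂ _∷_ (zeroʳ c) (⊡-zeroʳ {v} c)

  ⊞-inverseʳ : ∀ {v} (x : V v) → x ⊞ -V x ≡ zeroV
  ⊞-inverseʳ x = begin
    x ⊞ -V x               ≡⟨ cong (_⊞ -V x) (⊡-identityˡ x) ⟨
    1# ⊡ x ⊞ (- 1#) ⊡ x    ≡⟨ ⊡-distribʳ-⊕ 1# (- 1#) x ⟨
    (1# ⊕ - 1#) ⊡ x        ≡⟨ cong (_⊡ x) (-‿inverseʳ 1#) ⟩
    0# ⊡ x                 ≡⟨ ⊡-zeroˡ x ⟩
    zeroV                  ∎
    where open ≡-Reasoning

  ⊞-inverseˡ : ∀ {v} (x : V v) → -V x ⊞ x ≡ zeroV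
  ⊞-inverseˡ x = trans (⊞-comm (-V x) x) (⊞-inverseʳ x)

  x⊞y≡z⇒x≡z⊞-y : ∀ {v} {x y z : V v} → x ⊞ y ≡ z → x ≡ z ⊞ -V y
  x⊞y≡z⇒x≡z⊞-y {x = x} {y} refl = begin
    x                 ≡⟨ ⊞-identityʳ x ⟨
    x ⊞ zeroV         ≡⟨ cong (x ⊞_) (⊞-inverseʳ y) ⟨
    x ⊞ (y ⊞ -V y)    ≡⟨ ⊞-assoc x y (-V y) ⟨
    x ⊞ y ⊞ -V y      ∎
    where open ≡-Reasoning

  x≡z⊞-y⇒x⊞y≡z : ∀ {v} {x y z : V v} → x ≡ z ⊞ -V y → x ⊞ y ≡ z
  x≡z⊞-y⇒x⊞y≡z {y = y} {z} refl = begin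
    z ⊞ -V y ⊞ y      ≡⟨ ⊞-assoc z (-V y) y ⟩
    z ⊞ (-V y ⊞ y)    ≡⟨ cong (z ⊞_) (⊞-inverseˡ y) ⟩
    z ⊞ zeroV         ≡⟨ ⊞-identityʳ z ⟩
    z                 ∎
    where open ≡-Reasoning

  ⊞-cancelʳ : ∀ {v} {x y z : V v} → x ⊞ z ≡ y ⊞ z → x ≡ y
  ⊞-cancelʳ eq = trans (x⊞y≡z⇒x≡z⊞-y eq) (sym (x⊞y≡z⇒x≡z⊞-y refl))

  ⊞-interchange : ∀ {v} (w x y z : V v) → (w ⊞ x) ⊞ (y ⊞ z) ≡ (w ⊞ y) ⊞ (x ⊞ z)
  ⊞-interchange []       []       []       []       = refl
  ⊞-interchange (w ∷ ws) (x ∷ xs) (y ∷ ys) (z ∷ zs) = cong₂ _∷_ (interchange w x y z) (⊞-interchange ws xs ys zs)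

  ⊡-invertible : ∀ {c} → c ≢ 0# → ∃ λ w → ∀ {v} (x : V v) → w ⊡ c ⊡ x ≡ x
  ⊡-invertible {c} c≢0 with inverse c c≢0
  ... | w , cw≡1 = w , λ x → begin
    w ⊡ c ⊡ x     ≡⟨ ⊡-assoc w c x ⟨
    (w ⊗ c) ⊡ x   ≡⟨ cong (_⊡ x) (trans (*-comm w c) cw≡1) ⟩
    1# ⊡ x        ≡⟨ ⊡-identityˡ x ⟩
    x             ∎
    where open ≡-Reasoning

  ⊡≡zeroV⇒≡zeroV : ∀ {v c} {x : V v} → c ≢ 0# → c ⊡ x ≡ zeroV → x ≡ zeroV
  ⊡≡zeroV⇒≡zeroV {x = x} c≢0 eq with ⊡-invertible c≢0
  ... | w , w⊡c⊡ = trans (sym (w⊡c⊡ x)) (trans (cong (w ⊡_) eq) (⊡-zeroʳ w))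

  ·-comm : ∀ {v} (a x : V v) → a · x ≡ x · a
  ·-comm []       []       = refl
  ·-comm (a ∷ as) (x ∷ xs) = cong₂ _⊕_ (*-comm a x) (·-comm as xs)

  ·-distribˡ-⊞ : ∀ {v} (a x y : V v) → a · (x ⊞ y) ≡ a · x ⊕ a · y
  ·-distribˡ-⊞ []       []       []       = sym (+-identityˡ 0#)
  ·-distribˡ-⊞ (a ∷ as) (x ∷ xs) (y ∷ ys) =
    trans (cong₂ _⊕_ (distribˡ a x y) (·-distribˡ-⊞ as xs ys)) (interchange _ _ _ _)

  ·-distribʳ-⊞ : ∀ {v} (a b x : V v) → (a ⊞ b) · x ≡ a · x ⊕ b · x
  ·-distribʳ-⊞ a b x =
    trans (·-comm (a ⊞ b) x) (trans (·-distribˡ-⊞ x a b) (cong₂ _⊕_ (·-comm x a) (·-comm x b)))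

  ·-⊡ʳ : ∀ {v} (a : V v) c x → a · (c ⊡ x) ≡ c ⊗ a · x
  ·-⊡ʳ []       c []       = sym (zeroʳ c)
  ·-⊡ʳ (a ∷ as) c (x ∷ xs) =
    trans (cong₂ _⊕_ (x⊗yz≡y⊗xz a c x) (·-⊡ʳ as c xs)) (sym (distribˡ c _ _))

  ·-⊡ˡ : ∀ {v} c (a x : V v) → (c ⊡ a) · x ≡ c ⊗ a · x
  ·-⊡ˡ c a x = trans (·-comm (c ⊡ a) x) (trans (·-⊡ʳ x c a) (cong (c ⊗_) (·-comm x a)))

  ·-zeroʳ : ∀ {v} (a : V v) → a · zeroV ≡ 0#
  ·-zeroʳ []       = refl
  ·-zeroʳ (a ∷ as) = trans (cong₂ _⊕_ (zeroʳ a) (·-zeroʳ as)) (+-identityˡ 0#)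

  ·-zeroˡ : ∀ {v} (x : V v) → zeroV · x ≡ 0#
  ·-zeroˡ x = trans (·-comm zeroV x) (·-zeroʳ x)

  linComb-⊞ : ∀ {v k} (c c′ : V k) (B : Vec (V v) k) → linComb (c ⊞ c′) B ≡ linComb c B ⊞ linComb c′ B
  linComb-⊞ []       []         []       = sym (⊞-identityˡ zeroV)
  linComb-⊞ (c ∷ cs) (c′ ∷ cs′) (b ∷ bs) =
    trans (cong₂ _⊞_ (⊡-distribʳ-⊕ c c′ b) (linComb-⊞ cs cs′ bs)) (⊞-interchange _ _ _ _)

  linComb-⊡ : ∀ {v k} d (c : V k) (B : Vec (V v) k) → linComb (d ⊡ c) B ≡ d ⊡ linComb c B
  linComb-⊡ d []       []       = sym (⊡-zeroʳ d)
  linComb-⊡ d (c ∷ cs) (b ∷ bs) =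
    trans (cong₂ _⊞_ (⊡-assoc d c b) (linComb-⊡ d cs bs)) (sym (⊡-distribˡ-⊞ d _ _))

  linComb-injective : ∀ {v k} {B : Vec (V v) k} → LinIndep B → ∀ {c c′} → linComb c B ≡ linComb c′ B → c ≡ c′
  linComb-injective {B = B} indep {c} {c′} eq = ⊞-cancelʳ (trans (indep (c ⊞ -V c′) (begin
    linComb (c ⊞ -V c′) B                  ≡⟨ linComb-⊞ c (-V c′) B ⟩
    linComb c B ⊞ linComb (-V c′) B        ≡⟨ cong₂ _⊞_ eq (linComb-⊡ (- 1#) c′ B) ⟩
    linComb c′ B ⊞ -V linComb c′ B         ≡⟨ ⊞-inverseʳ _ ⟩
    zeroV                                  ∎)) (sym (⊞-inverseʳ c′)))
    where open ≡-Reasoning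

  private
    to : Fin q → Carrier
    to = Inverse.to enumeration

    from : Carrier → Fin q
    from = Inverse.from enumeration

  length-elems : length elems ≡ q
  length-elems = trans (List.length-map to (allFin q)) (List.length-tabulate id)

  ∑-allVecs-suc : ∀ v (f : V (suc v) → ℕ) → ∑ (allVecs (suc v)) f ≡ ∑[ c ∈ elems ] ∑[ x ∈ allVecs v ] f (c ∷ x)
  ∑-allVecs-suc v f = trans (∑-concatMap elems (λ c → map (c ∷_) (allVecs v)) f)
                            (∑-cong elems (λ c → ∑-map (allVecs v) (c ∷_) f))

  ∑-allVecs-const : ∀ v k → ∑[ _ ∈ allVecs v ] k ≡ q ^ v * k
  ∑-allVecs-const zero    k = trans (ℕ.+-identityʳ k) (sym (ℕ.*-identityˡ k))
  ∑-allVecs-const (suc v) k = begin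
    ∑[ _ ∈ allVecs (suc v) ] k    ≡⟨ ∑-allVecs-suc v (λ _ → k) ⟩
    ∑[ _ ∈ elems ] ∑[ _ ∈ allVecs v ] k ≡⟨ ∑-cong elems (λ _ → ∑-allVecs-const v k) ⟩
    ∑[ _ ∈ elems ] (q ^ v * k)    ≡⟨ ∑-const elems _ ⟩
    length elems * (q ^ v * k)    ≡⟨ cong (_* (q ^ v * k)) length-elems ⟩
    q * (q ^ v * k)               ≡⟨ ℕ.*-assoc q (q ^ v) k ⟨
    q ^ suc v * k                 ∎
    where open ≡-Reasoning

  ∑-elems-δ : ∀ d → ∑[ c ∈ elems ] 𝟙 (c ≟ d) ≡ 1
  ∑-elems-δ d = trans (∑-map (allFin q) to _) (trans (∑-cong (allFin q) (λ i → 𝟙-cong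
    (λ e → trans (sym (Inverse.strictlyInverseʳ enumeration i)) (cong from e))
    (λ e → trans (cong to e) (Inverse.strictlyInverseˡ enumeration d))
    (to i ≟ d) (i Fin.≟ from d))) (∑-allFin-δ q (from d)))

  ∑-allVecs-δ : ∀ {v} (z : V v) → ∑[ x ∈ allVecs v ] 𝟙 (x ≟V z) ≡ 1
  ∑-allVecs-δ []                = refl
  ∑-allVecs-δ {suc v} (d ∷ z) = begin
    ∑[ x ∈ allVecs (suc v) ] 𝟙 (x ≟V (d ∷ z))
      ≡⟨ ∑-allVecs-suc v _ ⟩
    ∑[ c ∈ elems ] ∑[ x ∈ allVecs v ] 𝟙 ((c ∷ x) ≟V (d ∷ z))
      ≡⟨ ∑-cong elems (λ c → ∑-cong (allVecs v) (λ x → 𝟙-cong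
           (λ e → Vec.∷-injectiveˡ e , Vec.∷-injectiveʳ e) (λ (e , e′) → cong₂ _∷_ e e′)
           ((c ∷ x) ≟V (d ∷ z)) ((c ≟ d) ×-dec (x ≟V z)))) ⟩
    ∑[ c ∈ elems ] ∑[ x ∈ allVecs v ] 𝟙 ((c ≟ d) ×-dec (x ≟V z))
      ≡⟨ ∑-cong elems (λ c → trans (sym (∑-*ˡ (allVecs v) (𝟙 (c ≟ d)) (λ x → 𝟙 (x ≟V z))))
                                    (∑-cong (allVecs v) (λ x → 𝟙-× (c ≟ d) (x ≟V z)))) ⟨
    ∑[ c ∈ elems ] 𝟙 (c ≟ d) * (∑[ x ∈ allVecs v ] 𝟙 (x ≟V z))
      ≡⟨ ∑-cong elems (λ c → trans (cong (𝟙 (c ≟ d) *_) (∑-allVecs-δ z)) (ℕ.*-identityʳ _)) ⟩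
    ∑[ c ∈ elems ] 𝟙 (c ≟ d)
      ≡⟨ ∑-elems-δ d ⟩
    1 ∎
    where open ≡-Reasoning

  ∈-allVecs : ∀ {v} (x : V v) → x ∈ allVecs v
  ∈-allVecs {v} x with ∑≢0⇒ (allVecs v) (λ y → 𝟙 (y ≟V x)) (λ e → ℕ.1+n≢0 (trans (sym (∑-allVecs-δ x)) e))
  ... | y , y∈ , y≡x = subst (_∈ allVecs v) (𝟙≢0⇒ (y ≟V x) y≡x) y∈

  ∑-allVecs-δ* : ∀ {v} (z : V v) (g : V v → ℕ) → ∑[ x ∈ allVecs v ] 𝟙 (x ≟V z) * g x ≡ g z
  ∑-allVecs-δ* {v} z g = begin
    ∑[ x ∈ allVecs v ] 𝟙 (x ≟V z) * g x  ≡⟨ ∑-cong (allVecs v) at-z ⟩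
    ∑[ x ∈ allVecs v ] 𝟙 (x ≟V z) * g z  ≡⟨ ∑-*ʳ (allVecs v) (g z) _ ⟩
    (∑[ x ∈ allVecs v ] 𝟙 (x ≟V z)) * g z ≡⟨ cong (_* g z) (∑-allVecs-δ z) ⟩
    1 * g z                               ≡⟨ ℕ.*-identityˡ (g z) ⟩
    g z                                   ∎
    where
    open ≡-Reasoning
    at-z : ∀ x → 𝟙 (x ≟V z) * g x ≡ 𝟙 (x ≟V z) * g z
    at-z x with x ≟V z
    ... | yes refl = refl
    ... | no _     = refl

  ∑-allVecs-translate : ∀ {v} (b : V v) (g : V v → ℕ) → ∑[ a ∈ allVecs v ] g (a ⊞ b) ≡ ∑ (allVecs v) g
  ∑-allVecs-translate {v} b g = begin
    ∑[ a ∈ allVecs v ] g (a ⊞ b)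
      ≡⟨ ∑-cong (allVecs v) (λ a → trans (sym (∑-allVecs-δ* (a ⊞ b) g)) (∑-cong (allVecs v) λ y →
           cong (_* g y) (𝟙-cong sym sym (y ≟V (a ⊞ b)) ((a ⊞ b) ≟V y)))) ⟩
    ∑[ a ∈ allVecs v ] ∑[ y ∈ allVecs v ] 𝟙 ((a ⊞ b) ≟V y) * g y
      ≡⟨ ∑-comm (allVecs v) (allVecs v) _ ⟩
    ∑[ y ∈ allVecs v ] ∑[ a ∈ allVecs v ] 𝟙 ((a ⊞ b) ≟V y) * g y
      ≡⟨ ∑-cong (allVecs v) (λ y → ∑-*ʳ (allVecs v) (g y) _) ⟩
    ∑[ y ∈ allVecs v ] (∑[ a ∈ allVecs v ] 𝟙 ((a ⊞ b) ≟V y)) * g y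
      ≡⟨ ∑-cong (allVecs v) (λ y → cong (_* g y) (trans
           (∑-cong (allVecs v) (λ a → 𝟙-cong x⊞y≡z⇒x≡z⊞-y x≡z⊞-y⇒x⊞y≡z ((a ⊞ b) ≟V y) (a ≟V (y ⊞ -V b))))
           (∑-allVecs-δ (y ⊞ -V b)))) ⟩
    ∑[ y ∈ allVecs v ] (1 * g y)
      ≡⟨ ∑-cong (allVecs v) (λ y → ℕ.*-identityˡ (g y)) ⟩
    ∑ (allVecs v) g ∎
    where open ≡-Reasoning

  -- Translating by t ⊡ b carries the level set L = 0 onto L = t without changing h, so all q level
  -- sets of L carry the same h-mass.
  module _ {v} (L : V v → Carrier) {b : V v} (L-shift : ∀ a t → L (a ⊞ t ⊡ b) ≡ L a ⊕ t)
           (h : V v → ℕ) (h-shift : ∀ a t → h (a ⊞ t ⊡ b) ≡ h a) where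

    private
      fibre : Carrier → ℕ
      fibre c = ∑[ a ∈ allVecs v ] h a * 𝟙 (L a ≟ c)

      fibre≡kernel : ∀ c → fibre c ≡ fibre 0#
      fibre≡kernel c = trans (sym (∑-allVecs-translate (c ⊡ b) _)) (∑-cong (allVecs v) (λ a →
        cong₂ _*_ (h-shift a c) (𝟙-cong
          (λ e → ⊕-identityˡ-unique (L a) c (trans (sym (L-shift a c)) e))
          (λ e → trans (L-shift a c) (trans (cong (_⊕ c) e) (+-identityˡ c)))
          (L (a ⊞ c ⊡ b) ≟ c) (L a ≟ 0#))))

    q*∑[L≡0]≡∑ : q * (∑[ a ∈ allVecs v ] h a * 𝟙 (L a ≟ 0#)) ≡ ∑ (allVecs v) h
    q*∑[L≡0]≡∑ = begin
      q * fibre 0#                                        ≡⟨ cong (_* fibre 0#) length-elems ⟨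
      length elems * fibre 0#                             ≡⟨ ∑-const elems (fibre 0#) ⟨
      ∑[ c ∈ elems ] fibre 0#                             ≡⟨ ∑-cong elems fibre≡kernel ⟨
      ∑[ c ∈ elems ] ∑[ a ∈ allVecs v ] h a * 𝟙 (L a ≟ c) ≡⟨ ∑-comm elems (allVecs v) _ ⟩
      ∑[ a ∈ allVecs v ] ∑[ c ∈ elems ] h a * 𝟙 (L a ≟ c) ≡⟨ ∑-cong (allVecs v) (λ a → ∑-*ˡ elems (h a) _) ⟩
      ∑[ a ∈ allVecs v ] h a * (∑[ c ∈ elems ] 𝟙 (L a ≟ c))
        ≡⟨ ∑-cong (allVecs v) (λ a → cong (h a *_)
             (trans (∑-cong elems (λ c → 𝟙-cong sym sym _ _)) (∑-elems-δ (L a)))) ⟩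
      ∑[ a ∈ allVecs v ] h a * 1                          ≡⟨ ∑-cong (allVecs v) (λ a → ℕ.*-identityʳ (h a)) ⟩
      ∑ (allVecs v) h                                     ∎
      where open ≡-Reasoning

    q*∑[L≢0]+∑≡q*∑ :
      q * (∑[ a ∈ allVecs v ] h a * 𝟙 (¬? (L a ≟ 0#))) + ∑ (allVecs v) h ≡ q * ∑ (allVecs v) h
    q*∑[L≢0]+∑≡q*∑ = begin
      q * off + ∑ (allVecs v) h  ≡⟨ cong (q * off +_) q*∑[L≡0]≡∑ ⟨
      q * off + q * on           ≡⟨ trans (ℕ.*-distribˡ-+ q on off) (ℕ.+-comm (q * on) (q * off)) ⟨
      q * (on + off)             ≡⟨ cong (q *_) (trans (sym (∑-+ (allVecs v) _ _))
                                                       (∑-cong (allVecs v) (λ a → *𝟙+*𝟙¬ (h a) (L a ≟ 0#)))) ⟩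
      q * ∑ (allVecs v) h        ∎
      where
      open ≡-Reasoning
      on off : ℕ
      on  = ∑[ a ∈ allVecs v ] h a * 𝟙 (L a ≟ 0#)
      off = ∑[ a ∈ allVecs v ] h a * 𝟙 (¬? (L a ≟ 0#))

  ·-shift : ∀ {v} {b y : V v} → b · y ≡ 1# → ∀ a t → (a ⊞ t ⊡ b) · y ≡ a · y ⊕ t
  ·-shift {b = b} {y} b·y≡1 a t =
    trans (·-distribʳ-⊞ a (t ⊡ b) y) (cong (a · y ⊕_) (trans (·-⊡ˡ t b y) (trans (cong (t ⊗_) b·y≡1) (*-identityʳ t))))

  ·-shift-invariant : ∀ {v} {b y : V v} → b · y ≡ 0# → ∀ a t → (a ⊞ t ⊡ b) · y ≡ a · y
  ·-shift-invariant {b = b} {y} b·y≡0 a t =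
    trans (·-distribʳ-⊞ a (t ⊡ b) y) (trans (cong (a · y ⊕_) (trans (·-⊡ˡ t b y) (trans (cong (t ⊗_) b·y≡0) (zeroʳ t))))
                                            (+-identityʳ _))

  ≢zeroV⇒∃·≡1# : ∀ {v} (y : V v) → y ≢ zeroV → ∃ λ b → b · y ≡ 1#
  ≢zeroV⇒∃·≡1# []       y≢0 = ⊥-elim (y≢0 refl)
  ≢zeroV⇒∃·≡1# (y ∷ ys) y≢0 with y ≟ 0#
  ... | no y≢0# with inverse y y≢0#
  ...   | w , yw≡1 = w ∷ zeroV , trans (cong₂ _⊕_ (*-comm w y) (·-zeroˡ ys)) (trans (+-identityʳ _) yw≡1)
  ≢zeroV⇒∃·≡1# (y ∷ ys) y≢0 | yes refl with ≢zeroV⇒∃·≡1# ys (λ e → y≢0 (cong (0# ∷_) e))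
  ... | b , b·ys≡1 = 0# ∷ b , trans (cong₂ _⊕_ (zeroˡ 0#) b·ys≡1) (+-identityˡ 1#)

  Normalized⇒≢zeroV : ∀ {v} {y : V v} → Normalized y → y ≢ zeroV
  Normalized⇒≢zeroV {y = y ∷ ys} (inj₁ y≡1)       e = 0≢1 (trans (sym (Vec.∷-injectiveˡ e)) y≡1)
  Normalized⇒≢zeroV {y = y ∷ ys} (inj₂ (_ , ys↓)) e = Normalized⇒≢zeroV ys↓ (Vec.∷-injectiveʳ e)

  Normalized-irrelevant : ∀ {v} {x : V v} (n n′ : Normalized x) → n ≡ n′
  Normalized-irrelevant {x = x ∷ xs} (inj₁ e)       (inj₁ e′)        = cong inj₁ (Decidable⇒UIP.≡-irrelevant _≟_ e e′)
  Normalized-irrelevant {x = x ∷ xs} (inj₁ e)       (inj₂ (e′ , _))  = ⊥-elim (0≢1 (trans (sym e′) e))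
  Normalized-irrelevant {x = x ∷ xs} (inj₂ (e , _)) (inj₁ e′)        = ⊥-elim (0≢1 (trans (sym e) e′))
  Normalized-irrelevant {x = x ∷ xs} (inj₂ (e , n)) (inj₂ (e′ , n′)) =
    cong₂ (λ e n → inj₂ (e , n)) (Decidable⇒UIP.≡-irrelevant _≟_ e e′) (Normalized-irrelevant n n′)

  Normalized-⊡⇒≡1# : ∀ {v c} {x : V v} → Normalized x → Normalized (c ⊡ x) → c ≡ 1#
  Normalized-⊡⇒≡1# {c = c} {x ∷ xs} (inj₁ refl) (inj₁ e)        = trans (sym (*-identityʳ c)) e
  Normalized-⊡⇒≡1# {c = c} {x ∷ xs} (inj₁ refl) (inj₂ (e , n))  =
    ⊥-elim (Normalized⇒≢zeroV n (trans (cong (_⊡ xs) (trans (sym (*-identityʳ c)) e)) (⊡-zeroˡ xs)))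
  Normalized-⊡⇒≡1# {c = c} {x ∷ xs} (inj₂ (refl , n)) (inj₁ e)  = ⊥-elim (0≢1 (trans (sym (zeroʳ c)) e))
  Normalized-⊡⇒≡1# {c = c} {x ∷ xs} (inj₂ (refl , n)) (inj₂ (_ , n′)) = Normalized-⊡⇒≡1# n n′

  -x⊗y≡-y⊗x : ∀ x y → - x ⊗ y ≡ - y ⊗ x
  -x⊗y≡-y⊗x x y = trans (sym (-‿distribˡ-* x y)) (trans (cong -_ (*-comm x y)) (-‿distribˡ-* y x))

  separate : ∀ {v} {x : V v} (y : V v) → Normalized x → (∃ λ c → y ≡ c ⊡ x) ⊎ (∃ λ a → a · x ≡ 0# × a · y ≡ 1#)
  separate {x = 1# ∷ xs} (y ∷ ys) (inj₁ refl) with (ys ⊞ (- y) ⊡ xs) ≟V zeroV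
  ... | yes ys≡y⊡xs = inj₁ (y , cong₂ _∷_ (sym (*-identityʳ y)) (begin
    ys                      ≡⟨ x⊞y≡z⇒x≡z⊞-y ys≡y⊡xs ⟩
    zeroV ⊞ -V ((- y) ⊡ xs) ≡⟨ ⊞-identityˡ _ ⟩
    (- 1#) ⊡ (- y) ⊡ xs     ≡⟨ ⊡-assoc (- 1#) (- y) xs ⟨
    (- 1# ⊗ - y) ⊡ xs       ≡⟨ cong (_⊡ xs) (trans (-x⊗y≡-y⊗x 1# (- y)) (trans (*-identityʳ _) (-‿involutive y))) ⟩
    y ⊡ xs                  ∎))
    where open ≡-Reasoning
  ... | no ys≢y⊡xs with ≢zeroV⇒∃·≡1# (ys ⊞ (- y) ⊡ xs) ys≢y⊡xs
  ...   | b , b·ys-y⊡xs≡1 = inj₂ ((- D) ∷ b , trans (cong (_⊕ D) (*-identityʳ (- D))) (-‿inverseˡ D) , (begin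
    - D ⊗ y ⊕ b · ys              ≡⟨ trans (cong (_⊕ b · ys) (-x⊗y≡-y⊗x D y)) (+-comm _ _) ⟩
    b · ys ⊕ - y ⊗ D              ≡⟨ cong (b · ys ⊕_) (·-⊡ʳ b (- y) xs) ⟨
    b · ys ⊕ b · ((- y) ⊡ xs)     ≡⟨ ·-distribˡ-⊞ b ys _ ⟨
    b · (ys ⊞ (- y) ⊡ xs)         ≡⟨ b·ys-y⊡xs≡1 ⟩
    1#                            ∎))
    where
    open ≡-Reasoning
    D : Carrier
    D = b · xs
  separate {x = 0# ∷ xs} (y ∷ ys) (inj₂ (refl , xs↓)) with separate ys xs↓
  ... | inj₂ (b , b·xs≡0 , b·ys≡1) =
    inj₂ (0# ∷ b , trans (cong₂ _⊕_ (zeroˡ 0#) b·xs≡0) (+-identityˡ 0#) ,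
                   trans (cong₂ _⊕_ (zeroˡ y) b·ys≡1) (+-identityˡ 1#))
  ... | inj₁ (c , ys≡c⊡xs) with y ≟ 0#
  ...   | yes refl = inj₁ (c , cong₂ _∷_ (sym (zeroʳ c)) ys≡c⊡xs)
  ...   | no y≢0 with inverse y y≢0
  ...     | w , yw≡1 = inj₂ (w ∷ zeroV , trans (cong₂ _⊕_ (zeroʳ w) (·-zeroˡ xs)) (+-identityˡ 0#) ,
                                         trans (cong₂ _⊕_ (*-comm w y) (·-zeroˡ ys)) (trans (+-identityʳ _) yw≡1))

  separate-distinct : ∀ {v} {x y : V v} → Normalized x → Normalized y → x ≢ y → ∃ λ a → a · x ≡ 0# × a · y ≡ 1#
  separate-distinct {x = x} {y} x↓ y↓ x≢y with separate y x↓
  ... | inj₂ a = a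
  ... | inj₁ (c , refl) = ⊥-elim (x≢y (sym (trans (cong (_⊡ x) (Normalized-⊡⇒≡1# x↓ y↓)) (⊡-identityˡ x))))

  zeroAt nonzeroAt : ∀ {v} → V v → V v → ℕ
  zeroAt    a x = 𝟙 (a · x ≟ 0#)
  nonzeroAt a x = 𝟙 (¬? (a · x ≟ 0#))

  kernel-count : ∀ {v} {a : V v} → a ≢ zeroV → q * (∑[ x ∈ allVecs v ] zeroAt a x) ≡ q ^ v
  kernel-count {v} {a} a≢0 with ≢zeroV⇒∃·≡1# a a≢0
  ... | b , b·a≡1 = begin
    q * (∑[ x ∈ allVecs v ] zeroAt a x)          ≡⟨ cong (q *_) (∑-cong (allVecs v) λ x →
                                                      trans (𝟙-cong (trans (·-comm x a)) (trans (·-comm a x)) _ _)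
                                                            (sym (ℕ.*-identityˡ _))) ⟩
    q * (∑[ x ∈ allVecs v ] 1 * 𝟙 (x · a ≟ 0#))  ≡⟨ q*∑[L≡0]≡∑ (_· a) {b} (·-shift b·a≡1) (λ _ → 1) (λ _ _ → refl) ⟩
    ∑[ x ∈ allVecs v ] 1                          ≡⟨ trans (∑-allVecs-const v 1) (ℕ.*-identityʳ _) ⟩
    q ^ v                                         ∎
    where open ≡-Reasoning

  nonvanishing-pair-count : ∀ {v} {x y : V v} → Normalized x → Normalized y → x ≢ y →
    q * (∑[ a ∈ allVecs v ] nonzeroAt a x * nonzeroAt a y) + (∑[ a ∈ allVecs v ] nonzeroAt a x)
      ≡ q * (∑[ a ∈ allVecs v ] nonzeroAt a x)
  nonvanishing-pair-count {x = x} {y} x↓ y↓ x≢y with separate-distinct x↓ y↓ x≢y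
  ... | b , b·x≡0 , b·y≡1 = q*∑[L≢0]+∑≡q*∑ (_· y) {b} (·-shift b·y≡1) (λ a → nonzeroAt a x)
    (λ a t → 𝟙-cong (λ ne e → ne (trans (·-shift-invariant b·x≡0 a t) e))
                    (λ ne e → ne (trans (sym (·-shift-invariant b·x≡0 a t)) e)) _ _)

  χ≡𝟙-inSpan : ∀ {v k} (B : Vec (V v) k) x → χ B x ≡ 𝟙 (inSpan? B x)
  χ≡𝟙-inSpan B x with inSpan? B x
  ... | yes _ = refl
  ... | no _  = refl

  inSpan-intro : ∀ {v k} (B : Vec (V v) k) c → InSpan B (linComb c B)
  inSpan-intro B c = lose (∈-allVecs c) refl

  𝟙-inSpan≡#coefficients : ∀ {v k} {B : Vec (V v) k} → LinIndep B → ∀ x →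
    𝟙 (inSpan? B x) ≡ ∑[ c ∈ allVecs k ] 𝟙 (linComb c B ≟V x)
  𝟙-inSpan≡#coefficients {k = k} {B} indep x with inSpan? B x
  ... | yes x∈B with Any.satisfied x∈B
  ...   | c₀ , refl = sym (trans (∑-cong (allVecs k) (λ c →
          𝟙-cong (linComb-injective indep) (cong (λ c → linComb c B)) (linComb c B ≟V linComb c₀ B) (c ≟V c₀)))
          (∑-allVecs-δ c₀))
  𝟙-inSpan≡#coefficients {k = k} {B} indep x | no x∉B = sym (trans
    (∑-cong (allVecs k) (λ c → 𝟙-no (λ { refl → x∉B (inSpan-intro B c) }) (linComb c B ≟V x)))
    (trans (∑-allVecs-const k 0) (ℕ.*-zeroʳ (q ^ k))))

  span-size : ∀ {v k} {B : Vec (V v) k} → LinIndep B → ∑[ x ∈ allVecs v ] 𝟙 (inSpan? B x) ≡ q ^ k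
  span-size {v} {k} {B} indep = begin
    ∑[ x ∈ allVecs v ] 𝟙 (inSpan? B x)                         ≡⟨ ∑-cong (allVecs v) (𝟙-inSpan≡#coefficients indep) ⟩
    ∑[ x ∈ allVecs v ] ∑[ c ∈ allVecs k ] 𝟙 (linComb c B ≟V x) ≡⟨ ∑-comm (allVecs v) (allVecs k) _ ⟩
    ∑[ c ∈ allVecs k ] ∑[ x ∈ allVecs v ] 𝟙 (linComb c B ≟V x) ≡⟨ ∑-cong (allVecs k) (λ c →
                                                                   trans (∑-cong (allVecs v) (λ x → 𝟙-cong sym sym _ _))
                                                                         (∑-allVecs-δ (linComb c B))) ⟩
    ∑[ c ∈ allVecs k ] 1                                       ≡⟨ trans (∑-allVecs-const k 1) (ℕ.*-identityʳ _) ⟩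
    q ^ k                                                      ∎
    where open ≡-Reasoning

  1<q : 1 < q
  1<q = distinct⇒1<n (from 0#) (from 1#) (λ e → 0≢1 (begin
    0#           ≡⟨ Inverse.strictlyInverseˡ enumeration 0# ⟨
    to (from 0#) ≡⟨ cong to e ⟩
    to (from 1#) ≡⟨ Inverse.strictlyInverseˡ enumeration 1# ⟩
    1#           ∎))
    where
    open ≡-Reasoning
    distinct⇒1<n : ∀ {n} (i j : Fin n) → i ≢ j → 1 < n
    distinct⇒1<n {suc zero}    Fin.zero Fin.zero i≢j = ⊥-elim (i≢j refl)
    distinct⇒1<n {suc (suc n)} _        _        _   = s≤s (s≤s z≤n)

  LinIndep⇒≤ : ∀ {v k} {B : Vec (V v) k} → LinIndep B → k ≤ v
  LinIndep⇒≤ {v} {k} {B} indep with ℕ.≤-<-connex k v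
  ... | inj₁ k≤v = k≤v
  ... | inj₂ v<k = ⊥-elim (ℕ.<-irrefl refl (ℕ.<-≤-trans (ℕ.^-monoʳ-< q 1<q v<k) (begin
    q ^ k                                 ≡⟨ span-size indep ⟨
    ∑[ x ∈ allVecs v ] 𝟙 (inSpan? B x)   ≤⟨ ∑-mono-≤ (allVecs v) (λ x → 𝟙≤1 (inSpan? B x)) ⟩
    ∑[ x ∈ allVecs v ] 1                  ≡⟨ trans (∑-allVecs-const v 1) (ℕ.*-identityʳ _) ⟩
    q ^ v                                 ∎)))
    where open ℕ.≤-Reasoning

  LinIndep-∷ : ∀ {v k} {B : Vec (V v) k} {u} → LinIndep B → ¬ InSpan B u → LinIndep (u ∷ B)
  LinIndep-∷ {B = B} {u} indep u∉B (c₀ ∷ cs) eq with c₀ ≟ 0#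
  ... | yes refl = cong (0# ∷_) (indep cs (trans (sym (⊞-identityˡ _))
                                               (trans (cong (_⊞ linComb cs B) (sym (⊡-zeroˡ u))) eq)))
  ... | no c₀≢0 with ⊡-invertible c₀≢0
  ...   | w , w⊡c₀⊡ = ⊥-elim (u∉B (subst (InSpan B) combination≡u (inSpan-intro B ((w ⊗ - 1#) ⊡ cs))))
    where
    open ≡-Reasoning
    combination≡u : linComb ((w ⊗ - 1#) ⊡ cs) B ≡ u
    combination≡u = begin
      linComb ((w ⊗ - 1#) ⊡ cs) B       ≡⟨ trans (linComb-⊡ (w ⊗ - 1#) cs B) (⊡-assoc w (- 1#) _) ⟩
      w ⊡ -V linComb cs B               ≡⟨ cong (w ⊡_) (trans (sym (⊞-identityˡ _)) (sym (x⊞y≡z⇒x≡z⊞-y eq))) ⟩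
      w ⊡ c₀ ⊡ u                        ≡⟨ w⊡c₀⊡ u ⟩
      u                                 ∎

  normalize : ∀ {v} (x : V v) → x ≢ zeroV → ∃ λ c → ∃ λ y → c ≢ 0# × Normalized y × c ⊡ y ≡ x
  normalize []       x≢0 = ⊥-elim (x≢0 refl)
  normalize (x ∷ xs) x≢0 with x ≟ 0#
  ... | no x≢0# with inverse x x≢0#
  ...   | w , xw≡1 = x , 1# ∷ w ⊡ xs , x≢0# , inj₁ refl ,
                     cong₂ _∷_ (*-identityʳ x)
                               (trans (sym (⊡-assoc x w xs)) (trans (cong (_⊡ xs) xw≡1) (⊡-identityˡ xs)))
  normalize (x ∷ xs) x≢0 | yes refl with normalize xs (λ e → x≢0 (cong (0# ∷_) e))
  ... | c , y , c≢0 , y↓ , c⊡y≡xs = c , 0# ∷ y , c≢0 , inj₂ (refl , y↓) , cong₂ _∷_ (zeroʳ c) c⊡y≡xs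

  ⊡-Normalized-injective : ∀ {v c c′} {y y′ : V v} → c′ ≢ 0# → Normalized y → Normalized y′ →
    c ⊡ y ≡ c′ ⊡ y′ → c ≡ c′ × y ≡ y′
  ⊡-Normalized-injective {c = c} {c′} {y} {y′} c′≢0 y↓ y′↓ eq with inverse c′ c′≢0
  ... | w , c′w≡1 = c≡c′ , sym y′≡y
    where
    open ≡-Reasoning
    y′≡[w⊗c]⊡y : y′ ≡ (w ⊗ c) ⊡ y
    y′≡[w⊗c]⊡y = begin
      y′              ≡⟨ ⊡-identityˡ y′ ⟨
      1# ⊡ y′         ≡⟨ cong (_⊡ y′) (trans (*-comm w c′) c′w≡1) ⟨
      (w ⊗ c′) ⊡ y′   ≡⟨ ⊡-assoc w c′ y′ ⟩
      w ⊡ c′ ⊡ y′     ≡⟨ cong (w ⊡_) eq ⟨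
      w ⊡ c ⊡ y       ≡⟨ ⊡-assoc w c y ⟨
      (w ⊗ c) ⊡ y     ∎
    w⊗c≡1 : w ⊗ c ≡ 1#
    w⊗c≡1 = Normalized-⊡⇒≡1# y↓ (subst Normalized y′≡[w⊗c]⊡y y′↓)
    y′≡y : y′ ≡ y
    y′≡y = trans y′≡[w⊗c]⊡y (trans (cong (_⊡ y) w⊗c≡1) (⊡-identityˡ y))
    c≡c′ : c ≡ c′
    c≡c′ = begin
      c               ≡⟨ *-identityˡ c ⟨
      1# ⊗ c          ≡⟨ cong (_⊗ c) c′w≡1 ⟨
      c′ ⊗ w ⊗ c      ≡⟨ *-assoc c′ w c ⟩
      c′ ⊗ (w ⊗ c)    ≡⟨ cong (c′ ⊗_) w⊗c≡1 ⟩
      c′ ⊗ 1#         ≡⟨ *-identityʳ c′ ⟩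
      c′              ∎

  scalar≢0? : ∀ c → Dec (c ≢ 0#)
  scalar≢0? c = ¬? (c ≟ 0#)

  representation? : ∀ {v} (x : V v) c y → Dec ((c ≢ 0# × Normalized y) × c ⊡ y ≡ x)
  representation? x c y = (scalar≢0? c ×-dec normalized? y) ×-dec ((c ⊡ y) ≟V x)

  #representations : ∀ {v} (x : V v) →
    ∑[ c ∈ elems ] ∑[ y ∈ allVecs v ] 𝟙 (representation? x c y) ≡ 𝟙 (¬? (x ≟V zeroV))
  #representations {v} x with x ≟V zeroV
  ... | yes refl = trans (∑-cong elems (λ c → trans (∑-cong (allVecs v) (λ y → 𝟙-no
          (λ ((c≢0 , y↓) , c⊡y≡0) → Normalized⇒≢zeroV y↓ (⊡≡zeroV⇒≡zeroV c≢0 c⊡y≡0)) _))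
          (trans (∑-allVecs-const v 0) (ℕ.*-zeroʳ (q ^ v)))))
        (trans (∑-const elems 0) (ℕ.*-zeroʳ (length elems)))
  ... | no x≢0 with normalize x x≢0
  ...   | c₀ , y₀ , c₀≢0 , y₀↓ , c₀⊡y₀≡x = begin
    ∑[ c ∈ elems ] ∑[ y ∈ allVecs v ] 𝟙 (representation? x c y)
      ≡⟨ ∑-cong elems (λ c → ∑-cong (allVecs v) (λ y → trans (𝟙-cong
           (λ ((_ , y↓) , c⊡y≡x) → ⊡-Normalized-injective c₀≢0 y↓ y₀↓ (trans c⊡y≡x (sym c₀⊡y₀≡x)))
           (λ { (refl , refl) → (c₀≢0 , y₀↓) , c₀⊡y₀≡x }) _ _) (sym (𝟙-× (c ≟ c₀) (y ≟V y₀))))) ⟩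
    ∑[ c ∈ elems ] ∑[ y ∈ allVecs v ] 𝟙 (c ≟ c₀) * 𝟙 (y ≟V y₀)
      ≡⟨ ∑-cong elems (λ c → trans (∑-*ˡ (allVecs v) (𝟙 (c ≟ c₀)) (λ y → 𝟙 (y ≟V y₀)))
                                   (trans (cong (𝟙 (c ≟ c₀) *_) (∑-allVecs-δ y₀)) (ℕ.*-identityʳ _))) ⟩
    ∑[ c ∈ elems ] 𝟙 (c ≟ c₀)
      ≡⟨ ∑-elems-δ c₀ ⟩
    1 ∎
    where open ≡-Reasoning

  ∑-nonzero≡∑-scaled-normalized : ∀ {v} (h : V v → ℕ) →
    ∑[ x ∈ allVecs v ] 𝟙 (¬? (x ≟V zeroV)) * h x
      ≡ ∑[ c ∈ elems ] ∑[ y ∈ allVecs v ] 𝟙 (scalar≢0? c ×-dec normalized? y) * h (c ⊡ y)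
  ∑-nonzero≡∑-scaled-normalized {v} h = begin
    ∑[ x ∈ allVecs v ] 𝟙 (¬? (x ≟V zeroV)) * h x
      ≡⟨ ∑-cong (allVecs v) (λ x → cong (_* h x) (#representations x)) ⟨
    ∑[ x ∈ allVecs v ] (∑[ c ∈ elems ] ∑[ y ∈ allVecs v ] 𝟙 (representation? x c y)) * h x
      ≡⟨ ∑-cong (allVecs v) (λ x → trans (∑-cong elems (λ c → ∑-*ʳ (allVecs v) (h x) _)) (∑-*ʳ elems (h x) _)) ⟨
    ∑[ x ∈ allVecs v ] ∑[ c ∈ elems ] ∑[ y ∈ allVecs v ] 𝟙 (representation? x c y) * h x
      ≡⟨ trans (∑-comm (allVecs v) elems _) (∑-cong elems (λ c → ∑-comm (allVecs v) (allVecs v) _)) ⟩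
    ∑[ c ∈ elems ] ∑[ y ∈ allVecs v ] ∑[ x ∈ allVecs v ] 𝟙 (representation? x c y) * h x
      ≡⟨ ∑-cong elems (λ c → ∑-cong (allVecs v) (λ y → evaluate c y)) ⟩
    ∑[ c ∈ elems ] ∑[ y ∈ allVecs v ] 𝟙 (scalar≢0? c ×-dec normalized? y) * h (c ⊡ y) ∎
    where
    open ≡-Reasoning
    evaluate : ∀ c y →
      ∑[ x ∈ allVecs v ] 𝟙 (representation? x c y) * h x ≡ 𝟙 (scalar≢0? c ×-dec normalized? y) * h (c ⊡ y)
    evaluate c y = begin
      ∑[ x ∈ allVecs v ] 𝟙 (representation? x c y) * h x
        ≡⟨ ∑-cong (allVecs v) (λ x → cong (_* h x) (sym (𝟙-× (scalar≢0? c ×-dec normalized? y) ((c ⊡ y) ≟V x)))) ⟩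
      ∑[ x ∈ allVecs v ] 𝟙 (scalar≢0? c ×-dec normalized? y) * 𝟙 ((c ⊡ y) ≟V x) * h x
        ≡⟨ trans (∑-cong (allVecs v) (λ x → ℕ.*-assoc (𝟙 (scalar≢0? c ×-dec normalized? y)) _ _))
                 (∑-*ˡ (allVecs v) (𝟙 (scalar≢0? c ×-dec normalized? y)) (λ x → 𝟙 ((c ⊡ y) ≟V x) * h x)) ⟩
      𝟙 (scalar≢0? c ×-dec normalized? y) * (∑[ x ∈ allVecs v ] 𝟙 ((c ⊡ y) ≟V x) * h x)
        ≡⟨ cong (𝟙 (scalar≢0? c ×-dec normalized? y) *_) (trans
             (∑-cong (allVecs v) (λ x → cong (_* h x) (𝟙-cong sym sym ((c ⊡ y) ≟V x) (x ≟V (c ⊡ y)))))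
             (∑-allVecs-δ* (c ⊡ y) h)) ⟩
      𝟙 (scalar≢0? c ×-dec normalized? y) * h (c ⊡ y) ∎

  1+#nonzero-scalars≡q : 1 + (∑[ c ∈ elems ] 𝟙 (scalar≢0? c)) ≡ q
  1+#nonzero-scalars≡q = begin
    1 + #nonzero                                        ≡⟨ cong (_+ #nonzero) (∑-elems-δ 0#) ⟨
    (∑[ c ∈ elems ] 𝟙 (c ≟ 0#)) + #nonzero              ≡⟨ ∑-+ elems _ _ ⟨
    ∑[ c ∈ elems ] (𝟙 (c ≟ 0#) + 𝟙 (scalar≢0? c))       ≡⟨ ∑-cong elems (λ c → 𝟙+𝟙¬ (c ≟ 0#)) ⟩
    ∑[ c ∈ elems ] 1                                    ≡⟨ trans (∑-const elems 1) (ℕ.*-identityʳ _) ⟩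
    length elems                                        ≡⟨ length-elems ⟩
    q                                                   ∎
    where
    open ≡-Reasoning
    #nonzero : ℕ
    #nonzero = ∑[ c ∈ elems ] 𝟙 (scalar≢0? c)

  record IsSubspace {v} (U : V v → Set) : Set where
    field
      zeroV∈ : U zeroV
      ⊞-closed : ∀ {x y} → U x → U y → U (x ⊞ y)
      ⊡-closed : ∀ c {x} → U x → U (c ⊡ x)

  record Basis {v} (U : V v → Set) : Set where
    field
      dim         : ℕ
      vectors     : Vec (V v) dim
      independent : LinIndep vectors
      span⊆       : ∀ {x} → InSpan vectors x → U x
      ⊆span       : ∀ {x} → U x → InSpan vectors x

  module _ {v} {U : V v → Set} (U? : ∀ x → Dec (U x)) (U-subspace : IsSubspace U) where
    open IsSubspace U-subspace

    private
      span-∷⊆ : ∀ {k} {B : Vec (V v) k} {u} → (∀ {x} → InSpan B x → U x) → U u → ∀ {x} → InSpan (u ∷ B) x → U x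
      span-∷⊆ {B = B} {u} B⊆U u∈U x∈ with Any.satisfied x∈
      ... | c₀ ∷ cs , refl = ⊞-closed (⊡-closed c₀ u∈U) (B⊆U (inSpan-intro B cs))

      -- fuel + k = v + 1 together with LinIndep⇒≤ makes the greedy extension terminate.
      extend : ∀ fuel {k} → fuel + k ≡ suc v → (B : Vec (V v) k) → LinIndep B → (∀ {x} → InSpan B x → U x) → Basis U
      extend fuel {k} fuel+k≡1+v B indep B⊆U with Any.any? (λ u → U? u ×-dec ¬? (inSpan? B u)) (allVecs v)
      ... | no none = record { dim = k ; vectors = B ; independent = indep ; span⊆ = B⊆U ; ⊆span = U⊆B }
        where
        U⊆B : ∀ {x} → U x → InSpan B x
        U⊆B {x} x∈U with inSpan? B x
        ... | yes x∈B = x∈B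
        ... | no x∉B  = ⊥-elim (none (lose (∈-allVecs x) (x∈U , x∉B)))
      ... | yes found with Any.satisfied found | fuel
      ...   | u , u∈U , u∉B | zero       = ⊥-elim (ℕ.<-irrefl refl (subst (_≤ v) fuel+k≡1+v (LinIndep⇒≤ indep)))
      ...   | u , u∈U , u∉B | suc fuel′  =
        extend fuel′ (trans (ℕ.+-suc fuel′ k) fuel+k≡1+v) (u ∷ B) (LinIndep-∷ indep u∉B) (span-∷⊆ B⊆U u∈U)

    basis : Basis U
    basis = extend (suc v) (ℕ.+-identityʳ (suc v)) [] (λ { [] _ → refl }) []⊆U
      where
      []⊆U : ∀ {x} → InSpan [] x → U x
      []⊆U x∈ with Any.satisfied x∈
      ... | [] , refl = zeroV∈

    subspace-size : (b : Basis U) → ∑[ x ∈ allVecs v ] 𝟙 (U? x) ≡ q ^ Basis.dim b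
    subspace-size b =
      trans (∑-cong (allVecs v) (λ x → 𝟙-cong ⊆span span⊆ (U? x) (inSpan? vectors x))) (span-size independent)
      where open Basis b

    #points : ℕ
    #points = ∑[ y ∈ allVecs v ] 𝟙 (normalized? y) * 𝟙 (U? y)

    size+#points≡1+q*#points : (∑[ x ∈ allVecs v ] 𝟙 (U? x)) + #points ≡ 1 + q * #points
    size+#points≡1+q*#points = begin
      (∑[ x ∈ allVecs v ] 𝟙 (U? x)) + #points
        ≡⟨ cong (_+ #points) (trans (∑-cong (allVecs v) split) (∑-+ (allVecs v) _ _)) ⟩
      (∑[ x ∈ allVecs v ] 𝟙 (x ≟V zeroV)) + (∑[ x ∈ allVecs v ] 𝟙 (¬? (x ≟V zeroV)) * 𝟙 (U? x)) + #points
        ≡⟨ cong₂ (λ m n → m + n + #points) (∑-allVecs-δ (zeroV {v})) (∑-nonzero≡∑-scaled-normalized (𝟙 ∘ U?)) ⟩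
      1 + (∑[ c ∈ elems ] ∑[ y ∈ allVecs v ] 𝟙 (scalar≢0? c ×-dec normalized? y) * 𝟙 (U? (c ⊡ y))) + #points
        ≡⟨ cong (λ n → 1 + n + #points) (trans (∑-cong elems (λ c → trans (∑-cong (allVecs v) (rescale c))
                                                                          (∑-*ˡ (allVecs v) (𝟙 (scalar≢0? c)) _)))
                                               (∑-*ʳ elems #points _)) ⟩
      1 + (∑[ c ∈ elems ] 𝟙 (scalar≢0? c)) * #points + #points
        ≡⟨ regroup (∑[ c ∈ elems ] 𝟙 (scalar≢0? c)) #points ⟩
      1 + (1 + (∑[ c ∈ elems ] 𝟙 (scalar≢0? c))) * #points
        ≡⟨ cong (λ n → 1 + n * #points) 1+#nonzero-scalars≡q ⟩
      1 + q * #points ∎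
      where
      open ≡-Reasoning
      split : ∀ x → 𝟙 (U? x) ≡ 𝟙 (x ≟V zeroV) + 𝟙 (¬? (x ≟V zeroV)) * 𝟙 (U? x)
      split x with x ≟V zeroV
      ... | yes refl = 𝟙-yes zeroV∈ (U? zeroV)
      ... | no _     = sym (ℕ.+-identityʳ _)
      rescale : ∀ c y →
        𝟙 (scalar≢0? c ×-dec normalized? y) * 𝟙 (U? (c ⊡ y)) ≡ 𝟙 (scalar≢0? c) * (𝟙 (normalized? y) * 𝟙 (U? y))
      rescale c y = trans (cong (_* 𝟙 (U? (c ⊡ y))) (sym (𝟙-× (scalar≢0? c) (normalized? y))))
                          (trans (ℕ.*-assoc (𝟙 (scalar≢0? c)) _ _) (unscale (scalar≢0? c)))
        where
        unscale : (c≢0? : Dec (c ≢ 0#)) →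
          𝟙 c≢0? * (𝟙 (normalized? y) * 𝟙 (U? (c ⊡ y))) ≡ 𝟙 c≢0? * (𝟙 (normalized? y) * 𝟙 (U? y))
        unscale (no _)     = refl
        unscale (yes c≢0) with ⊡-invertible c≢0
        ... | w , w⊡c⊡ = cong (λ n → 1 * (𝟙 (normalized? y) * n))
                           (𝟙-cong (λ u → subst U (w⊡c⊡ y) (⊡-closed w u)) (⊡-closed c) (U? (c ⊡ y)) (U? y))
      regroup : ∀ m n → 1 + m * n + n ≡ 1 + (1 + m) * n
      regroup = solve-∀

  kernel-subspace : ∀ {v} (a : V v) → IsSubspace (λ x → a · x ≡ 0#)
  kernel-subspace a = record
    { zeroV∈   = ·-zeroʳ a
    ; ⊞-closed = λ {x} {y} a·x≡0 a·y≡0 → trans (·-distribˡ-⊞ a x y) (trans (cong₂ _⊕_ a·x≡0 a·y≡0) (+-identityˡ 0#))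
    ; ⊡-closed = λ c {x} a·x≡0 → trans (·-⊡ʳ a c x) (trans (cong (c ⊗_) a·x≡0) (zeroʳ c))
    }

  module _ {v} (M : Multiset v) where

    inMass offMass : V v → ℕ
    inMass  a = ∑[ x ∈ allVecs v ] mult M x * zeroAt a x
    offMass a = ∑[ x ∈ allVecs v ] mult M x * nonzeroAt a x

    inMass+offMass≡card : ∀ a → inMass a + offMass a ≡ card M
    inMass+offMass≡card a =
      trans (sym (∑-+ (allVecs v) _ _)) (∑-cong (allVecs v) (λ x → *𝟙+*𝟙¬ (mult M x) (a · x ≟ 0#)))

    offMass-zeroV : offMass zeroV ≡ 0
    offMass-zeroV = trans (∑-cong (allVecs v) (λ x → trans (cong (mult M x *_) (𝟙-no (λ ne → ne (·-zeroˡ x)) _))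
                                                          (ℕ.*-zeroʳ (mult M x))))
                          (trans (∑-allVecs-const v 0) (ℕ.*-zeroʳ (q ^ v)))

    mult-Normalized : ∀ {x : V v} (x↓ : Normalized x) → mult M x ≡ M (x , x↓)
    mult-Normalized {x} x↓ with normalized? x
    ... | yes x↓′ = cong (λ n → M (x , n)) (Normalized-irrelevant x↓′ x↓)
    ... | no ¬x↓  = ⊥-elim (¬x↓ x↓)

    mult-¬Normalized : ∀ {x : V v} → ¬ Normalized x → mult M x ≡ 0
    mult-¬Normalized {x} ¬x↓ with normalized? x
    ... | yes x↓ = ⊥-elim (¬x↓ x↓)
    ... | no _   = refl

    Divisible⇒∣offMass : ∀ {Δ} → Divisible Δ M → ∀ {a} → a ≢ zeroV → Δ ∣ offMass a
    Divisible⇒∣offMass {Δ} M-divisible {a} a≢0 =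
      m+n≡o∧d∣m-o⇒d∣n (inMass+offMass≡card a)
        (subst (λ n → n ≡ card M [mod Δ ]) massOf≡inMass (M-divisible dim 1+dim≡v vectors independent))
      where
      ker : Basis (λ x → a · x ≡ 0#)
      ker = basis (λ x → a · x ≟ 0#) (kernel-subspace a)
      open Basis ker
      1+dim≡v : suc dim ≡ v
      1+dim≡v = ^-injectiveʳ q 1<q (trans (cong (q *_) (sym (subspace-size (λ x → a · x ≟ 0#) (kernel-subspace a) ker)))
                                           (kernel-count a≢0))
      massOf≡inMass : massOf M vectors ≡ inMass a
      massOf≡inMass = ∑-cong (allVecs v) (λ x → cong (mult M x *_)
        (trans (χ≡𝟙-inSpan vectors x) (𝟙-cong span⊆ ⊆span (inSpan? vectors x) (a · x ≟ 0#))))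

  module DivisibleMultiset {v r l} (l≤r : l ≤ r) (M : Multiset v) (M-divisible : Divisible (q ^ r) M)
           (M-card : card M ≡ q ^ l * gaussNum q (suc r ∸ l)) where

    private
      N Q : ℕ
      N = card M
      Q = q ^ r

      m : V v → ℕ
      m = mult M

      0<q^ : ∀ n → 0 < q ^ n
      0<q^ = ℕ.m^n>0 q {{ℕ.>-nonZero (ℕ.<-trans (s≤s z≤n) 1<q)}}

    balance : q * Q + N ≡ q * N + q ^ l
    balance = subst (λ n → q * Q + n ≡ q * n + q ^ l) (sym M-card) (q*q^r+N≡q*N+q^l q l≤r)

    offMass≢0⇒≡Q : ∀ {a} → offMass M a ≢ 0 → offMass M a ≡ Q
    offMass≢0⇒≡Q {a} g≢0 = m∣n∧0<n<2m⇒n≡m (ℕ.n≢0⇒n>0 g≢0)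
      (ℕ.≤-<-trans (subst (offMass M a ≤_) (inMass+offMass≡card M a) (ℕ.m≤n+m _ (inMass M a)))
                   (q*m+n≡q*n+e⇒n<2m 1<q (0<q^ l) balance))
      (Divisible⇒∣offMass M M-divisible {a} (λ { refl → g≢0 (offMass-zeroV M) }))

    -- The subspace of the theorem: the intersection of the hyperplanes that contain all of M.
    K : V v → Set
    K x = ∀ a → offMass M a ≡ 0 → a · x ≡ 0#

    K? : ∀ x → Dec (K x)
    K? x = map′ (λ h a → All.lookup h (∈-allVecs a)) (λ h → All.tabulate (λ {a} _ → h a))
                (all? (λ a → (offMass M a ℕ.≟ 0) →-dec (a · x ≟ 0#)) (allVecs v))

    K-subspace : IsSubspace K
    K-subspace = record
      { zeroV∈   = λ a _ → IsSubspace.zeroV∈ (kernel-subspace a)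
      ; ⊞-closed = λ x∈K y∈K a g≡0 → IsSubspace.⊞-closed (kernel-subspace a) (x∈K a g≡0) (y∈K a g≡0)
      ; ⊡-closed = λ c x∈K a g≡0 → IsSubspace.⊡-closed (kernel-subspace a) c (x∈K a g≡0)
      }

    support⊆K : ∀ {x} → m x ≢ 0 → K x
    support⊆K {x} mx≢0 a g≡0 with a · x ≟ 0#
    ... | yes a·x≡0 = a·x≡0
    ... | no a·x≢0  = ⊥-elim (mx≢0 (begin
      m x                    ≡⟨ ℕ.*-identityʳ (m x) ⟨
      m x * 1                ≡⟨ cong (m x *_) (𝟙-yes a·x≢0 (¬? (a · x ≟ 0#))) ⟨
      m x * nonzeroAt a x    ≡⟨ ∑≡0⇒ (allVecs v) (λ y → m y * nonzeroAt a y) (∈-allVecs x) g≡0 ⟩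
      0                      ∎))
      where open ≡-Reasoning

    module _ {x : V v} (x↓ : Normalized x) (x∈K : K x) where
      private
        E : ℕ
        E = ∑[ a ∈ allVecs v ] nonzeroAt a x

        pairs : V v → ℕ
        pairs y = ∑[ a ∈ allVecs v ] nonzeroAt a x * nonzeroAt a y

        E≢0 : E ≢ 0
        E≢0 E≡0 with ≢zeroV⇒∃·≡1# x (Normalized⇒≢zeroV x↓)
        ... | b , b·x≡1 = ℕ.1+n≢0 (trans (sym (𝟙-yes (λ e → 0≢1 (trans (sym e) b·x≡1)) (¬? (b · x ≟ 0#))))
                                         (∑≡0⇒ (allVecs v) (λ a → nonzeroAt a x) (∈-allVecs b) E≡0))

      ∑offMass≡Q*E : ∑[ a ∈ allVecs v ] nonzeroAt a x * offMass M a ≡ Q * E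
      ∑offMass≡Q*E = trans (∑-cong (allVecs v) weight) (∑-*ˡ (allVecs v) Q _)
        where
        weight : ∀ a → nonzeroAt a x * offMass M a ≡ Q * nonzeroAt a x
        weight a with a · x ≟ 0#
        ... | yes _    = sym (ℕ.*-zeroʳ Q)
        ... | no a·x≢0 = trans (ℕ.+-identityʳ _)
                               (trans (offMass≢0⇒≡Q {a} (λ g≡0 → a·x≢0 (x∈K a g≡0))) (sym (ℕ.*-identityʳ Q)))

      ∑offMass-by-points : ∑[ a ∈ allVecs v ] nonzeroAt a x * offMass M a ≡ ∑[ y ∈ allVecs v ] m y * pairs y
      ∑offMass-by-points = begin
        ∑[ a ∈ allVecs v ] nonzeroAt a x * offMass M a
          ≡⟨ ∑-cong (allVecs v) (λ a → sym (∑-*ˡ (allVecs v) (nonzeroAt a x) _)) ⟩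
        ∑[ a ∈ allVecs v ] ∑[ y ∈ allVecs v ] nonzeroAt a x * (m y * nonzeroAt a y)
          ≡⟨ ∑-comm (allVecs v) (allVecs v) _ ⟩
        ∑[ y ∈ allVecs v ] ∑[ a ∈ allVecs v ] nonzeroAt a x * (m y * nonzeroAt a y)
          ≡⟨ ∑-cong (allVecs v) (λ y → trans (∑-cong (allVecs v) (λ a → exchange (nonzeroAt a x) (m y) _))
                                             (∑-*ˡ (allVecs v) (m y) _)) ⟩
        ∑[ y ∈ allVecs v ] m y * pairs y ∎
        where
        open ≡-Reasoning
        exchange : ∀ i j k → i * (j * k) ≡ j * (i * k)
        exchange = solve-∀

      -- pairs y counts the functionals vanishing neither at x nor at y: E if y = x, (q-1)E/q otherwise.
      pair-weight : ∀ y → q * (m y * pairs y) + m y * E ≡ q * (m y * E) + m y * 𝟙 (y ≟V x) * E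
      pair-weight y with y ≟V x
      ... | yes refl = cong₂ (λ p n → q * (m y * p) + n * E)
                             (∑-cong (allVecs v) (λ a → 𝟙-idem (¬? (a · y ≟ 0#)))) (sym (ℕ.*-identityʳ (m y)))
      ... | no y≢x   = off-diagonal (normalized? y)
        where
        expand : ∀ q n p e → q * (n * p) + n * e ≡ n * (q * p + e)
        expand = solve-∀
        contract : ∀ q n e → n * (q * e) ≡ q * (n * e) + n * 0 * e
        contract = solve-∀
        off-diagonal : Dec (Normalized y) → q * (m y * pairs y) + m y * E ≡ q * (m y * E) + m y * 0 * E
        off-diagonal (yes y↓) = trans (expand q (m y) (pairs y) E)
                                      (trans (cong (m y *_) (nonvanishing-pair-count x↓ y↓ (λ e → y≢x (sym e))))
                                             (contract q (m y) E))
        off-diagonal (no ¬y↓) = subst (λ n → q * (n * pairs y) + n * E ≡ q * (n * E) + n * 0 * E)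
                                      (sym (mult-¬Normalized M ¬y↓)) refl

      ∑pair-weight : q * (∑[ y ∈ allVecs v ] m y * pairs y) + N * E ≡ q * (N * E) + m x * E
      ∑pair-weight = begin
        q * (∑[ y ∈ allVecs v ] m y * pairs y) + N * E
          ≡⟨ cong₂ _+_ (∑-*ˡ (allVecs v) q _) (∑-*ʳ (allVecs v) E m) ⟨
        (∑[ y ∈ allVecs v ] q * (m y * pairs y)) + (∑[ y ∈ allVecs v ] m y * E)
          ≡⟨ ∑-+ (allVecs v) _ _ ⟨
        ∑[ y ∈ allVecs v ] (q * (m y * pairs y) + m y * E)
          ≡⟨ ∑-cong (allVecs v) pair-weight ⟩
        ∑[ y ∈ allVecs v ] (q * (m y * E) + m y * 𝟙 (y ≟V x) * E)
          ≡⟨ ∑-+ (allVecs v) _ _ ⟩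
        (∑[ y ∈ allVecs v ] q * (m y * E)) + (∑[ y ∈ allVecs v ] m y * 𝟙 (y ≟V x) * E)
          ≡⟨ cong₂ _+_ (trans (∑-*ˡ (allVecs v) q _) (cong (q *_) (∑-*ʳ (allVecs v) E m)))
                       (trans (∑-*ʳ (allVecs v) E _) (cong (_* E) (trans (∑-cong (allVecs v) (λ y → ℕ.*-comm (m y) _))
                                                                         (∑-allVecs-δ* x m)))) ⟩
        q * (N * E) + m x * E ∎
        where open ≡-Reasoning

      mult≡q^l : m x ≡ q ^ l
      mult≡q^l = ℕ.+-cancelˡ-≡ (q * N) (m x) (q ^ l) (trans (sym q*Q+N≡q*N+mx) balance)
        where
        open ≡-Reasoning
        q*Q+N≡q*N+mx : q * Q + N ≡ q * N + m x
        q*Q+N≡q*N+mx = ℕ.*-cancelʳ-≡ _ _ E {{ℕ.≢-nonZero E≢0}} (begin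
          (q * Q + N) * E                                  ≡⟨ distribute q Q N E ⟩
          q * (Q * E) + N * E                              ≡⟨ cong (λ n → q * n + N * E) ∑offMass≡Q*E ⟨
          q * (∑[ a ∈ allVecs v ] nonzeroAt a x * offMass M a) + N * E
                                                           ≡⟨ cong (λ n → q * n + N * E) ∑offMass-by-points ⟩
          q * (∑[ y ∈ allVecs v ] m y * pairs y) + N * E   ≡⟨ ∑pair-weight ⟩
          q * (N * E) + m x * E                            ≡⟨ distribute q N (m x) E ⟨
          (q * N + m x) * E                                ∎)
          where
          distribute : ∀ q a b e → (q * a + b) * e ≡ q * (a * e) + b * e
          distribute = solve-∀

    mult≡q^l*𝟙K : ∀ {x} → Normalized x → m x ≡ q ^ l * 𝟙 (K? x)
    mult≡q^l*𝟙K {x} x↓ with K? x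
    ... | yes x∈K = trans (mult≡q^l x↓ x∈K) (sym (ℕ.*-identityʳ _))
    ... | no x∉K with m x ℕ.≟ 0
    ...   | yes mx≡0 = trans mx≡0 (sym (ℕ.*-zeroʳ (q ^ l)))
    ...   | no mx≢0  = ⊥-elim (x∉K (support⊆K mx≢0))

    #points-K : #points K? K-subspace ≡ gaussNum q (suc r ∸ l)
    #points-K = ℕ.*-cancelˡ-≡ _ _ (q ^ l) {{ℕ.>-nonZero (0<q^ l)}} (trans (sym N≡q^l*#points) M-card)
      where
      N≡q^l*#points : N ≡ q ^ l * #points K? K-subspace
      N≡q^l*#points = trans (∑-cong (allVecs v) profile) (∑-*ˡ (allVecs v) (q ^ l) _)
        where
        profile : ∀ x → m x ≡ q ^ l * (𝟙 (normalized? x) * 𝟙 (K? x))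
        profile x = by-cases (normalized? x)
          where
          by-cases : (x↓? : Dec (Normalized x)) → m x ≡ q ^ l * (𝟙 x↓? * 𝟙 (K? x))
          by-cases (yes x↓) = trans (mult≡q^l*𝟙K x↓) (cong (q ^ l *_) (sym (ℕ.+-identityʳ _)))
          by-cases (no ¬x↓) = trans (mult-¬Normalized M ¬x↓) (sym (ℕ.*-zeroʳ (q ^ l)))

    dim-K : (b : Basis K) → Basis.dim b ≡ suc r ∸ l
    dim-K b = ^-injectiveʳ q 1<q (ℕ.+-cancelʳ-≡ _ _ _ (begin
      q ^ dim + G                                ≡⟨ cong₂ _+_ (subspace-size K? K-subspace b) #points-K ⟨
      (∑[ x ∈ allVecs v ] 𝟙 (K? x)) + #points K? K-subspace
                                                 ≡⟨ size+#points≡1+q*#points K? K-subspace ⟩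
      1 + q * #points K? K-subspace              ≡⟨ cong (λ n → 1 + q * n) #points-K ⟩
      gaussNum q (suc d)                         ≡⟨ gaussNum[1+m]≡q^m+gaussNum[m] q d ⟩
      q ^ d + G                                  ∎))
      where
      open ≡-Reasoning
      open Basis b
      d G : ℕ
      d = suc r ∸ l
      G = gaussNum q d

    M≡q^l*χ : (b : Basis K) (P : Point v) → M P ≡ q ^ l * χ (Basis.vectors b) (proj₁ P)
    M≡q^l*χ b (x , x↓) = begin
      M (x , x↓)                ≡⟨ mult-Normalized M x↓ ⟨
      m x                       ≡⟨ mult≡q^l*𝟙K x↓ ⟩
      q ^ l * 𝟙 (K? x)          ≡⟨ cong (q ^ l *_) (𝟙-cong ⊆span span⊆ (K? x) (inSpan? vectors x)) ⟩
      q ^ l * 𝟙 (inSpan? vectors x) ≡⟨ cong (q ^ l *_) (χ≡𝟙-inSpan vectors x) ⟨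
      q ^ l * χ vectors x       ∎
      where
      open ≡-Reasoning
      open Basis b

proposition3 : {q : ℕ} (F : FiniteField q) → IsPrimePower q →
    (v r l : ℕ) → l ≤ r → (M : Geometry.Multiset F v) →
    Geometry.Divisible F (q ^ r) M →
    Geometry.card F M ≡ q ^ l * gaussNum q (suc r ∸ l) →
    Σ (Vec (Geometry.V F v) (suc r ∸ l)) λ B →
    Geometry.LinIndep F B ×
    ((P : Geometry.Point F v) → M P ≡ q ^ l * Geometry.χ F B (proj₁ P))
proposition3 {q} F _ v r l l≤r M M-divisible M-card =
  subst Witness (dim-K K-basis) (vectors , independent , M≡q^l*χ K-basis)
  where
  open Geometry F using (V; LinIndep; Point; χ)
  open DivisibleMultiset F l≤r M M-divisible M-card
  K-basis : Basis F K
  K-basis = basis F K? K-subspace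
  open Basis K-basis
  Witness : ℕ → Set
  Witness k = Σ (Vec (V v) k) λ B → LinIndep B × ((P : Point v) → M P ≡ q ^ l * χ B (proj₁ P))
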